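{- For every $\varphi\in\mathsf{Form}_\Box$: if $\mathcal{MM}(\mathsf{CPC},\mathsf{IPC})\models\varphi$, then $\mathcal{CMM}\models\varphi$.
   Context: The modal language $\mathsf{Form}_\Box$ is generated by $\top$, $\bot$, propositional variables $p\in\mathsf{Prop}$, and $(\varphi\wedge\psi)$, $(\varphi\vee\psi)$, $(\varphi\to\psi)$, $\Box\varphi$; $\neg\varphi$ abbreviates $\varphi\to\bot$. $\mathsf{IPC}$ (over the modal language) is the Hilbert system whose axioms are all instances, with $A,B,C\in\mathsf{Form}_\Box$, of $A\to(B\to A)$; $(A\to B)\to((A\to(B\to C))\to(A\to C))$; $A\to(A\vee B)$; $B\to(A\vee B)$; $(A\vee B)\to((A\to C)\to((B\to C)\to C))$; $A\to(B\to(A\wedge B))$; $(A\wedge B)\to A$; $(A\wedge B)\to B$; $\bot\to A$; its only rule is modus ponens. $\mathsf{CPC}$ adds $\neg A\vee A$. $\Gamma\vdash_L\varphi$ denotes derivability from hypotheses $\Gamma$ using axioms of $L$ and modus ponens. The class $\mathcal{MM}(\mathsf{CPC},\mathsf{IPC})$ consists of triples $\langle W,R,\{T_w\}_{w\in W}\rangle$ with $W\ne\emptyset$, $R\subseteq W\times W$, $T_w\subseteq\mathsf{Form}_\Box$, such that for each $w$ there is $L_w\in\{\mathsf{CPC},\mathsf{IPC}\}$ with: (1) $\bot\notin T_w$; (2) $T_w\vdash_{L_w}\varphi\Rightarrow\varphi\in T_w$; (3) $\Box\varphi\in T_w$ iff $\varphi\in T_v$ for all $v$ with $wRv$; (4)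 $\neg\Box\varphi\in T_w$ iff $\varphi\notin T_v$ for some $v$ with $wRv$. $\mathcal{MM}(\mathsf{CPC},\mathsf{IPC})\models\varphi$ means $\varphi\in T_w$ for every such model and every $w\in W$. A concrete mixed model is $\langle W,R,\{\mathcal M_w\}_{w\in W}\rangle$ with $W\ne\emptyset$, $R\subseteq W\times W$, each $\mathcal M_w=\langle W_w,\leq_w,V_w\rangle$ a rooted intuitionistic Kripke model (partial order $\leq_w$, valuation $V_w:W_w\to\mathcal P(\mathsf{Prop})$ monotone in $\leq_w$) with root $\overline w$, domains pairwise disjoint; $\leq,V$ denote the unions. Forcing at a point $x\in\bigcup_wW_w$: $x\Vdash p$ iff $p\in V(x)$; $x\nVdash\bot$; $\wedge,\vee$ pointwise; $x\Vdash\varphi\to\psi$ iff every $y\geq x$ forcing $\varphi$ forces $\psi$; $x\Vdash\Box\varphi$ iff $\overline v\Vdash\varphi$ for all $v\in W$ with $wRv$, where $w$ is the unique element with $\overline w\leq x$. $\mathcal{CMM}$ is the class of concrete mixed models, and $\mathcal{CMM}\models\varphi$ means $\varphi$ is forced at every point of every concrete mixed model. -}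

module Defs where

open import Data.Nat using (ℕ)
open import Data.Product using (Σ; _×_)
open import Data.Sum using (_⊎_)
open import Data.Empty using (⊥)
open import Relation.Nullary using (¬_)
open import Relation.Binary.PropositionalEquality using (_≡_)

infixr 6 _∧_
infixr 5 _∨_
infixr 4 _⇒_
data Form : Set where
  ⊤f ⊥f : Form
  var   : ℕ → Form
  _∧_ _∨_ _⇒_ : Form → Form → Form
  □_    : Form → Form

~_ : Form → Form
~ A = A ⇒ ⊥f

data Logic : Set where
  CPC IPC : Logic

data Axiom : Logic → Form → Set where
  K   : ∀ {L} A B → Axiom L (A ⇒ (B ⇒ A))
  S   : ∀ {L} A B C → Axiom L ((A ⇒ B) ⇒ ((A ⇒ (B ⇒ C)) ⇒ (A ⇒ C)))
  ∨I₁ : ∀ {L} A B → Axiom L (A ⇒ (A ∨ B))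
  ∨I₂ : ∀ {L} A B → Axiom L (B ⇒ (A ∨ B))
  ∨E  : ∀ {L} A B C → Axiom L ((A ∨ B) ⇒ ((A ⇒ C) ⇒ ((B ⇒ C) ⇒ C)))
  ∧I  : ∀ {L} A B → Axiom L (A ⇒ (B ⇒ (A ∧ B)))
  ∧E₁ : ∀ {L} A B → Axiom L ((A ∧ B) ⇒ A)
  ∧E₂ : ∀ {L} A B → Axiom L ((A ∧ B) ⇒ B)
  ⊥E  : ∀ {L} A → Axiom L (⊥f ⇒ A)
  lem : ∀ A → Axiom CPC ((~ A) ∨ A)

data _⊢[_]_ (Γ : Form → Set) (L : Logic) : Form → Set where
  hyp : ∀ {φ} → Γ φ → Γ ⊢[ L ] φ
  ax  : ∀ {φ} → Axiom L φ → Γ ⊢[ L ] φ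
  mp  : ∀ {φ ψ} → Γ ⊢[ L ] (φ ⇒ ψ) → Γ ⊢[ L ] φ → Γ ⊢[ L ] ψ

record MMModel : Set₁ where
  field
    W      : Set
    w₀     : W
    R      : W → W → Set
    T      : W → Form → Set
    logic  : W → Logic
    consistent : ∀ w → ¬ T w ⊥f
    closed     : ∀ w φ → T w ⊢[ logic w ] φ → T w φ
    box→   : ∀ w φ → T w (□ φ) → (∀ v → R w v → T v φ)
    →box   : ∀ w φ → (∀ v → R w v → T v φ) → T w (□ φ)
    negbox→ : ∀ w φ → T w (~ (□ φ)) → Σ W (λ v → R w v × ¬ T v φ)
    →negbox : ∀ w φ → Σ W (λ v → R w v × ¬ T v φ) → T w (~ (□ φ))

MM⊨ : Form → Set₁
MM⊨ φ = (M : MMModel) → (w : MMModel.W M) → MMModel.T M w φ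

-- Concrete mixed models. The disjoint union of the domains W_w is
-- represented as the Σ-type of pairs (w , x) with x : Pt w, so the unique
-- w with root_w ≤ x is the first component.
record CMMModel : Set₁ where
  field
    W    : Set
    w₀   : W
    R    : W → W → Set
    Pt   : W → Set
    _≤_  : ∀ {w} → Pt w → Pt w → Set
    ≤-refl    : ∀ {w} (x : Pt w) → x ≤ x
    ≤-trans   : ∀ {w} {x y z : Pt w} → x ≤ y → y ≤ z → x ≤ z
    ≤-antisym : ∀ {w} {x y : Pt w} → x ≤ y → y ≤ x → x ≡ y
    root      : (w : W) → Pt w
    root-min  : ∀ {w} (x : Pt w) → root w ≤ x
    V         : ∀ {w} → Pt w → ℕ → Set
    V-mono    : ∀ {w} {x y : Pt w} p → x ≤ y → V x p → V y p

module _ (M : CMMModel) where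
  open CMMModel M
  forces : (w : W) → Pt w → Form → Set
  forces w x ⊤f = Data.Unit.⊤
    where import Data.Unit
  forces w x ⊥f = ⊥
  forces w x (var p) = V x p
  forces w x (φ ∧ ψ) = forces w x φ × forces w x ψ
  forces w x (φ ∨ ψ) = forces w x φ ⊎ forces w x ψ
  forces w x (φ ⇒ ψ) = ∀ y → x ≤ y → forces w y φ → forces w y ψ
  forces w x (□ φ) = ∀ v → R w v → forces v (root v) φ

CMM⊨ : Form → Set₁
CMM⊨ φ = (M : CMMModel) → (w : CMMModel.W M) → (x : CMMModel.Pt M w) → forces M w x φ

{-# OPTIONS --safe #-}
module Submission where

open import Defs
open import Level using (0ℓ)
open import Axiom.ExcludedMiddle using (ExcludedMiddle)
open import Axiom.DoubleNegationElimination using (DoubleNegationElimination; em⇒dne)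
open import Data.Product using (Σ; ∃; _×_; _,_; proj₁; proj₂)
open import Data.Sum using (inj₁; inj₂)
open import Relation.Nullary using (¬_)
open import Relation.Binary.PropositionalEquality using (_≡_; refl)

-- The points of a concrete mixed model form an MM-model: a point's theory is
-- the set of formulas it forces, with logic IPC, and it is consistent and
-- IPC-closed by soundness of Kripke semantics.  A point sees the roots of the
-- R-successors of its component, so the □-clauses hold because □φ is forced
-- at a point exactly when φ is forced at those roots; the clause for ~□φ uses
-- excluded middle to extract a root refuting φ.

classical-¬∀⟶∃¬ : ExcludedMiddle 0ℓ → {A : Set} {Q P : A → Set} →
                  ¬ (∀ x → Q x → P x) → ∃ λ x → Q x × ¬ P x
classical-¬∀⟶∃¬ em ¬∀ =
  dne λ ¬∃ → ¬∀ λ x q → dne λ ¬p → ¬∃ (x , q , ¬p)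
  where
  dne : DoubleNegationElimination 0ℓ
  dne = em⇒dne em

module _ (M : CMMModel) where
  open CMMModel M

  forces-mono : ∀ {w} {x y : Pt w} φ → x ≤ y → forces M w x φ → forces M w y φ
  forces-mono ⊤f      x≤y t        = t
  forces-mono ⊥f      x≤y ()
  forces-mono (var p) x≤y v        = V-mono p x≤y v
  forces-mono (φ ∧ ψ) x≤y (a , b)  = forces-mono φ x≤y a , forces-mono ψ x≤y b
  forces-mono (φ ∨ ψ) x≤y (inj₁ a) = inj₁ (forces-mono φ x≤y a)
  forces-mono (φ ∨ ψ) x≤y (inj₂ b) = inj₂ (forces-mono ψ x≤y b)
  forces-mono (φ ⇒ ψ) x≤y f        = λ z y≤z → f z (≤-trans x≤y y≤z)
  forces-mono (□ φ)   x≤y b        = b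

  forces-axiom : ∀ {w} (x : Pt w) {φ} → Axiom IPC φ → forces M w x φ
  forces-axiom x (K A B)   = λ y _ a z y≤z _ → forces-mono A y≤z a
  forces-axiom x (S A B C) = λ y _ f z y≤z g u z≤u a →
    g u z≤u a u (≤-refl u) (f u (≤-trans y≤z z≤u) a)
  forces-axiom x (∨I₁ A B) = λ _ _ → inj₁
  forces-axiom x (∨I₂ A B) = λ _ _ → inj₂
  forces-axiom x (∨E A B C) = λ
    { y _ (inj₁ a) z y≤z f u z≤u _ → f u z≤u (forces-mono A (≤-trans y≤z z≤u) a)
    ; y _ (inj₂ b) z y≤z _ u z≤u g → g u (≤-refl u) (forces-mono B (≤-trans y≤z z≤u) b)
    }
  forces-axiom x (∧I A B)  = λ y _ a z y≤z b → forces-mono A y≤z a , b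
  forces-axiom x (∧E₁ A B) = λ _ _ → proj₁
  forces-axiom x (∧E₂ A B) = λ _ _ → proj₂
  forces-axiom x (⊥E A)    = λ _ _ ()

  forces-closed : ∀ {w} (x : Pt w) {φ} → forces M w x ⊢[ IPC ] φ → forces M w x φ
  forces-closed x (hyp h)  = h
  forces-closed x (ax a)   = forces-axiom x a
  forces-closed x (mp d e) = forces-closed x d x (≤-refl x) (forces-closed x e)

  Point : Set
  Point = Σ W Pt

  _↝_ : Point → Point → Set
  (w , _) ↝ (v , y) = R w v × y ≡ root v

  ForcedAt : Point → Form → Set
  ForcedAt (w , x) = forces M w x

  box-elim : ∀ p φ → ForcedAt p (□ φ) → ∀ q → p ↝ q → ForcedAt q φ
  box-elim _ φ □φ (v , _) (wRv , refl) = □φ v wRv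

  box-intro : ∀ p φ → (∀ q → p ↝ q → ForcedAt q φ) → ForcedAt p (□ φ)
  box-intro _ φ h v wRv = h (v , root v) (wRv , refl)

  negbox-intro : ∀ p φ → Σ Point (λ q → p ↝ q × ¬ ForcedAt q φ) → ForcedAt p (~ (□ φ))
  negbox-intro _ φ ((v , _) , (wRv , refl) , ¬φ) _ _ □φ = ¬φ (□φ v wRv)

  negbox-elim : ExcludedMiddle 0ℓ →
                ∀ p φ → ForcedAt p (~ (□ φ)) → Σ Point (λ q → p ↝ q × ¬ ForcedAt q φ)
  negbox-elim em (_ , x) φ ¬□φ with classical-¬∀⟶∃¬ em (¬□φ x (≤-refl x))
  ... | v , wRv , ¬φ = (v , root v) , (wRv , refl) , ¬φ

  pointModel : ExcludedMiddle 0ℓ → MMModel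
  pointModel em = record
    { W          = Point
    ; w₀         = w₀ , root w₀
    ; R          = _↝_
    ; T          = ForcedAt
    ; logic      = λ _ → IPC
    ; consistent = λ _ ()
    ; closed     = λ (_ , x) _ → forces-closed x
    ; box→       = box-elim
    ; →box       = box-intro
    ; negbox→    = negbox-elim em
    ; →negbox    = negbox-intro
    }

theorem2p2p5 : ExcludedMiddle 0ℓ → (φ : Form) → MM⊨ φ → CMM⊨ φ
theorem2p2p5 em φ ⊨φ M w x = ⊨φ (pointModel M em) (w , x)
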